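{- Let $\Gamma$ be a finite $G$-arc-transitive digraph of valency $r\geq 4$, where $G\leq\mathrm{Aut}(\Gamma)$. Then $|\Gamma^+(u)\cap\Gamma^+(v)|\neq r-2$ for every arc $(u,v)$.
   Context: A digraph $\Gamma$ consists of a finite vertex set $V(\Gamma)$ with an antisymmetric irreflexive relation $\rightarrow$; an arc is an ordered pair $(u,v)$ with $u\rightarrow v$; $\Gamma^+(v)=\{w: v\rightarrow w\}$ and the valency is $|\Gamma^+(v)|$. $G$-arc-transitive means $G$ is transitive on the set of arcs. -}

module Defs where

open import Data.Nat using (ℕ)
open import Data.Bool using (Bool; true; false)
open import Data.Fin using (Fin)
open import Data.Fin.Subset using (Subset)
open import Data.Vec using (tabulate)
open import Data.Fin.Permutation using (Permutation′; _⟨$⟩ʳ_; id; flip; _∘ₚ_)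
open import Data.Product using (Σ; _×_; _,_)
open import Relation.Binary.PropositionalEquality using (_≡_)

record Digraph (n : ℕ) : Set where
  field
    arc         : Fin n → Fin n → Bool
    irreflexive : ∀ v → arc v v ≡ false
    antisym     : ∀ u v → arc u v ≡ true → arc v u ≡ false
open Digraph public

out : ∀ {n} → Digraph n → Fin n → Subset n
out Γ v = tabulate (λ w → arc Γ v w)

IsAut : ∀ {n} → Digraph n → Permutation′ n → Set
IsAut Γ σ = ∀ u v → arc Γ (σ ⟨$⟩ʳ u) (σ ⟨$⟩ʳ v) ≡ arc Γ u v

record IsAutSubgroup {n : ℕ} (Γ : Digraph n) (G : Permutation′ n → Set) : Set where
  field
    ⊆Aut   : ∀ σ → G σ → IsAut Γ σ
    has-id : G id
    ∘-closed : ∀ σ τ → G σ → G τ → G (σ ∘ₚ τ)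
    inv-closed : ∀ σ → G σ → G (flip σ)

ArcTransitive : ∀ {n} → Digraph n → (Permutation′ n → Set) → Set
ArcTransitive Γ G = ∀ u v x y → arc Γ u v ≡ true → arc Γ x y ≡ true →
  Σ _ (λ σ → G σ × ((σ ⟨$⟩ʳ u ≡ x) × (σ ⟨$⟩ʳ v ≡ y)))

-- Let λ = |Γ⁺(u) ∩ Γ⁺(x)|, the same for every arc (u, x) by arc-transitivity. For x ∈ Γ⁺(u),
-- the sets {x}, Γ⁺(u) ∩ Γ⁺(x) and Γ⁺(u) ∩ Γ⁻(x) are pairwise disjoint inside Γ⁺(u), so
-- |Γ⁺(u) ∩ Γ⁻(x)| ≤ r − 1 − λ. Summed over x ∈ Γ⁺(u), the left side counts the arcs inside
-- Γ⁺(u) by their heads, which is rλ when counted by their tails; hence rλ ≤ r(r − 1 − λ), i.e.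
-- 2λ < r, which fails for λ = r − 2 as soon as r ≥ 4.
module Submission where

open import Defs
open import Data.Nat using (ℕ; _≤_; _∸_)
open import Data.Bool using (true)
open import Data.Fin using (Fin)
open import Data.Fin.Subset using (_∩_; ∣_∣)
open import Data.Fin.Permutation using (Permutation′)
open import Relation.Binary.PropositionalEquality using (_≡_; _≢_)

open import Data.Nat using (zero; suc; _+_; _*_; _<_; z≤n; s≤s; >-nonZero)
open import Data.Nat.Properties
open import Data.Bool using (Bool; false; _∧_)
open import Data.Fin using (zero; suc)
open import Data.Vec using (_∷_; tabulate)
open import Data.Product using (_,_)
open import Data.Fin.Permutation using (_⟨$⟩ʳ_)
open import Relation.Binary.PropositionalEquality
  using (refl; sym; trans; cong; cong₂; subst; module ≡-Reasoning)
open import Algebra.Properties.Semiring.Sum +-*-semiring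
  using (sum; sum-cong-≗; ∑-comm; ∑-permute; ∑-distrib-+; *-distribˡ-sum; *-distribʳ-sum)

𝟙 : Bool → ℕ
𝟙 true  = 1
𝟙 false = 0

sum-mono-≤ : ∀ {n} {f g : Fin n → ℕ} → (∀ i → f i ≤ g i) → sum f ≤ sum g
sum-mono-≤ {zero}  f≤g = z≤n
sum-mono-≤ {suc n} f≤g = +-mono-≤ (f≤g zero) (sum-mono-≤ (λ i → f≤g (suc i)))

sum-mono-< : ∀ {n} {f g : Fin n → ℕ} → (∀ i → f i ≤ g i) → ∀ j → f j < g j → sum f < sum g
sum-mono-< f≤g zero    fj<gj = +-mono-<-≤ fj<gj (sum-mono-≤ (λ i → f≤g (suc i)))
sum-mono-< f≤g (suc j) fj<gj = +-mono-≤-< (f≤g zero) (sum-mono-< (λ i → f≤g (suc i)) j fj<gj)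

∣tabulate∣≡∑𝟙 : ∀ {n} (p : Fin n → Bool) → ∣ tabulate p ∣ ≡ sum (λ i → 𝟙 (p i))
∣tabulate∣≡∑𝟙 {zero}  p = refl
∣tabulate∣≡∑𝟙 {suc n} p with p zero
... | true  = cong suc (∣tabulate∣≡∑𝟙 (λ i → p (suc i)))
... | false = ∣tabulate∣≡∑𝟙 (λ i → p (suc i))

tabulate-∩ : ∀ {n} (p q : Fin n → Bool) → tabulate p ∩ tabulate q ≡ tabulate (λ i → p i ∧ q i)
tabulate-∩ {zero}  p q = refl
tabulate-∩ {suc n} p q = cong (p zero ∧ q zero ∷_) (tabulate-∩ (λ i → p (suc i)) (λ i → q (suc i)))

module _ {n : ℕ} (P : Fin n → Bool) where

  ∑∈ : (Fin n → ℕ) → ℕ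
  ∑∈ f = sum (λ x → 𝟙 (P x) * f x)

  ∑∈-const : ∀ c → ∑∈ (λ _ → c) ≡ sum (λ x → 𝟙 (P x)) * c
  ∑∈-const c = sym (*-distribʳ-sum c (λ x → 𝟙 (P x)))

  ∑∈-distrib-+ : ∀ f g → ∑∈ (λ x → f x + g x) ≡ ∑∈ f + ∑∈ g
  ∑∈-distrib-+ f g = trans (sum-cong-≗ (λ x → *-distribˡ-+ (𝟙 (P x)) (f x) (g x)))
                           (∑-distrib-+ (λ x → 𝟙 (P x) * f x) (λ x → 𝟙 (P x) * g x))

  ∑∈-cong : ∀ {f g} → (∀ x → P x ≡ true → f x ≡ g x) → ∑∈ f ≡ ∑∈ g
  ∑∈-cong {f} {g} f≡g = sum-cong-≗ pointwise
    where
    pointwise : ∀ x → 𝟙 (P x) * f x ≡ 𝟙 (P x) * g x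
    pointwise x with P x in Px
    ... | true  = cong (_+ 0) (f≡g x Px)
    ... | false = refl

  ∑∈-mono-≤ : ∀ {f g} → (∀ x → P x ≡ true → f x ≤ g x) → ∑∈ f ≤ ∑∈ g
  ∑∈-mono-≤ {f} {g} f≤g = sum-mono-≤ pointwise
    where
    pointwise : ∀ x → 𝟙 (P x) * f x ≤ 𝟙 (P x) * g x
    pointwise x with P x in Px
    ... | true  = +-monoˡ-≤ 0 (f≤g x Px)
    ... | false = z≤n

  ∑∈-in≡∑∈-out : (R : Fin n → Fin n → Bool) →
    ∑∈ (λ x → sum (λ y → 𝟙 (P y ∧ R y x))) ≡ ∑∈ (λ y → sum (λ x → 𝟙 (P x ∧ R y x)))
  ∑∈-in≡∑∈-out R = begin
    sum (λ x → 𝟙 (P x) * sum (λ y → 𝟙 (P y ∧ R y x)))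
      ≡⟨ sum-cong-≗ (λ x → *-distribˡ-sum (𝟙 (P x)) (λ y → 𝟙 (P y ∧ R y x))) ⟩
    sum (λ x → sum (λ y → 𝟙 (P x) * 𝟙 (P y ∧ R y x)))
      ≡⟨ ∑-comm (λ x y → 𝟙 (P x) * 𝟙 (P y ∧ R y x)) ⟩
    sum (λ y → sum (λ x → 𝟙 (P x) * 𝟙 (P y ∧ R y x)))
      ≡⟨ sum-cong-≗ (λ y → sum-cong-≗ (λ x → 𝟙-*-∧-exchange (P x) (P y) (R y x))) ⟩
    sum (λ y → sum (λ x → 𝟙 (P y) * 𝟙 (P x ∧ R y x)))
      ≡⟨ sum-cong-≗ (λ y → sym (*-distribˡ-sum (𝟙 (P y)) (λ x → 𝟙 (P x ∧ R y x)))) ⟩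
    sum (λ y → 𝟙 (P y) * sum (λ x → 𝟙 (P x ∧ R y x))) ∎
    where
    open ≡-Reasoning
    𝟙-*-∧-exchange : ∀ a b c → 𝟙 a * 𝟙 (b ∧ c) ≡ 𝟙 b * 𝟙 (a ∧ c)
    𝟙-*-∧-exchange false false c     = refl
    𝟙-*-∧-exchange false true  false = refl
    𝟙-*-∧-exchange false true  true  = refl
    𝟙-*-∧-exchange true  false false = refl
    𝟙-*-∧-exchange true  false true  = refl
    𝟙-*-∧-exchange true  true  c     = refl

module _ {n : ℕ} (Γ : Digraph n) where

  outdeg : Fin n → ℕ
  outdeg u = sum (λ w → 𝟙 (arc Γ u w))

  commonOut : Fin n → Fin n → ℕ
  commonOut u v = sum (λ w → 𝟙 (arc Γ u w ∧ arc Γ v w))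

  outIn : Fin n → Fin n → ℕ
  outIn u x = sum (λ y → 𝟙 (arc Γ u y ∧ arc Γ y x))

  ∣out∣≡outdeg : ∀ u → ∣ out Γ u ∣ ≡ outdeg u
  ∣out∣≡outdeg u = ∣tabulate∣≡∑𝟙 (arc Γ u)

  ∣out∩out∣≡commonOut : ∀ u v → ∣ out Γ u ∩ out Γ v ∣ ≡ commonOut u v
  ∣out∩out∣≡commonOut u v = trans (cong ∣_∣ (tabulate-∩ (arc Γ u) (arc Γ v)))
                                  (∣tabulate∣≡∑𝟙 (λ w → arc Γ u w ∧ arc Γ v w))

  commonOut-aut : ∀ σ → IsAut Γ σ → ∀ u v → commonOut (σ ⟨$⟩ʳ u) (σ ⟨$⟩ʳ v) ≡ commonOut u v
  commonOut-aut σ aut u v =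
    trans (∑-permute (λ w → 𝟙 (arc Γ (σ ⟨$⟩ʳ u) w ∧ arc Γ (σ ⟨$⟩ʳ v) w)) σ)
          (sum-cong-≗ (λ w → cong₂ (λ p q → 𝟙 (p ∧ q)) (aut u w) (aut v w)))

  commonOut-arcInvariant : ∀ {G} → (∀ σ → G σ → IsAut Γ σ) → ArcTransitive Γ G →
    ∀ {u v x y} → arc Γ u v ≡ true → arc Γ x y ≡ true → commonOut x y ≡ commonOut u v
  commonOut-arcInvariant G⊆Aut tr {u} {v} {x} {y} uv xy with tr u v x y uv xy
  ... | σ , Gσ , refl , refl = commonOut-aut σ (G⊆Aut σ Gσ) u v

  -- Γ⁺(u) ∩ Γ⁺(x) and Γ⁺(u) ∩ Γ⁻(x) are disjoint by antisymmetry and miss x ∈ Γ⁺(u).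
  commonOut+outIn<outdeg : ∀ {u x} → arc Γ u x ≡ true → commonOut u x + outIn u x < outdeg u
  commonOut+outIn<outdeg {u} {x} ux =
    subst (_< outdeg u) (∑-distrib-+ (λ y → 𝟙 (arc Γ u y ∧ arc Γ x y)) (λ y → 𝟙 (arc Γ u y ∧ arc Γ y x)))
      (sum-mono-< (λ y → 𝟙-∧-disjoint (arc Γ u y) (antisym Γ x y)) x at-x)
    where
    𝟙-∧-disjoint : ∀ a {b c} → (b ≡ true → c ≡ false) → 𝟙 (a ∧ b) + 𝟙 (a ∧ c) ≤ 𝟙 a
    𝟙-∧-disjoint false                _    = z≤n
    𝟙-∧-disjoint true  {false} {false} _    = z≤n
    𝟙-∧-disjoint true  {false} {true}  _    = s≤s z≤n
    𝟙-∧-disjoint true  {true}          b→¬c rewrite b→¬c refl = s≤s z≤n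
    at-x : 𝟙 (arc Γ u x ∧ arc Γ x x) + 𝟙 (arc Γ u x ∧ arc Γ x x) < 𝟙 (arc Γ u x)
    at-x rewrite ux | irreflexive Γ x = s≤s z≤n

  -- Summing the previous inequality over x ∈ Γ⁺(u), the outIn terms add up to the commonOut terms.
  commonOut-bound : ∀ {u v k} → arc Γ u v ≡ true → (∀ x → arc Γ u x ≡ true → commonOut u x ≡ k) →
    suc (k + k) ≤ outdeg u
  commonOut-bound {u} {v} {k} uv common≡k = *-cancelˡ-≤ d ⦃ >-nonZero d>0 ⦄ (begin
    d * suc (k + k)                     ≡⟨ *-distribˡ-+ d (suc k) k ⟩
    d * suc k + d * k                   ≡⟨ cong₂ _+_ (sym (∑∈-const Γ⁺u (suc k))) (sym (∑∈-const Γ⁺u k)) ⟩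
    ∑∈ Γ⁺u (λ _ → suc k) + ∑∈ Γ⁺u (λ _ → k)
      ≡⟨ cong (∑∈ Γ⁺u (λ _ → suc k) +_) (sym (∑∈-cong Γ⁺u common≡k)) ⟩
    ∑∈ Γ⁺u (λ _ → suc k) + ∑∈ Γ⁺u (commonOut u)
      ≡⟨ cong (∑∈ Γ⁺u (λ _ → suc k) +_) (sym (∑∈-in≡∑∈-out Γ⁺u (arc Γ))) ⟩
    ∑∈ Γ⁺u (λ _ → suc k) + ∑∈ Γ⁺u (outIn u)
      ≡⟨ sym (∑∈-distrib-+ Γ⁺u (λ _ → suc k) (outIn u)) ⟩
    ∑∈ Γ⁺u (λ x → suc k + outIn u x)    ≤⟨ ∑∈-mono-≤ Γ⁺u each≤d ⟩
    ∑∈ Γ⁺u (λ _ → d)                    ≡⟨ ∑∈-const Γ⁺u d ⟩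
    d * d                               ∎)
    where
    open ≤-Reasoning
    Γ⁺u = arc Γ u
    d = outdeg u
    d>0 : 0 < d
    d>0 = ≤-trans (s≤s z≤n) (commonOut+outIn<outdeg uv)
    each≤d : ∀ x → arc Γ u x ≡ true → suc k + outIn u x ≤ d
    each≤d x ux = subst (λ c → suc c + outIn u x ≤ d) (common≡k x ux) (commonOut+outIn<outdeg ux)

4≤r⇒r<1+2[r∸2] : ∀ {r} → 4 ≤ r → r < suc ((r ∸ 2) + (r ∸ 2))
4≤r⇒r<1+2[r∸2] {suc (suc (suc (suc m)))} (s≤s (s≤s (s≤s (s≤s _)))) = s≤s (s≤s (s≤s (m≤n+m (suc (suc m)) m)))

lemma4p6 : (n : ℕ) (Γ : Digraph n) (G : Permutation′ n → Set) (r : ℕ) →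
    IsAutSubgroup Γ G → ArcTransitive Γ G →
    (∀ v → ∣ out Γ v ∣ ≡ r) → 4 ≤ r →
    ∀ u v → arc Γ u v ≡ true → ∣ out Γ u ∩ out Γ v ∣ ≢ r ∸ 2
lemma4p6 n Γ G r sub tr deg 4≤r u v uv common≡r∸2 = <⇒≱ (4≤r⇒r<1+2[r∸2] 4≤r) bound
  where
  open IsAutSubgroup sub using (⊆Aut)
  constant : ∀ x → arc Γ u x ≡ true → commonOut Γ u x ≡ r ∸ 2
  constant x ux = trans (commonOut-arcInvariant Γ ⊆Aut tr uv ux)
                        (trans (sym (∣out∩out∣≡commonOut Γ u v)) common≡r∸2)
  bound : suc ((r ∸ 2) + (r ∸ 2)) ≤ r
  bound = subst (_ ≤_) (trans (sym (∣out∣≡outdeg Γ u)) (deg u)) (commonOut-bound Γ uv constant)
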